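{- For every integer $n\ge 6$, either the numerator of the rational number $v_n=\prod_{i=1}^n\frac{|\zeta(1-2i)|}{2}$ (written in lowest terms) is not $1$, or $v_n>1$.
   Context: $\zeta$ denotes the Riemann zeta function; each $\zeta(1-2i)$ is a nonzero rational number. -}

module Defs where

open import Data.Nat as ℕ using (ℕ; zero; suc)
open import Data.Nat.Combinatorics using (_C_)
open import Data.Integer as ℤ using (+_)
open import Data.Rational using (ℚ; _/_; _+_; _*_; -_; ∣_∣; 0ℚ; 1ℚ)
open import Data.List using (List; []; _∷_; _++_; [_]; foldr; length; last)
open import Data.Maybe using (fromMaybe)

-- Bernoulli numbers B_0, B_1, ... defined by B_0 = 1 and, for m ≥ 1,
--   Σ_{k=0}^{m} C(m+1,k) B_k = 0,  i.e.  B_m = -(1/(m+1)) Σ_{k<m} C(m+1,k) B_k.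
-- (Convention B_1 = -1/2; only even indices are used below.)

weightedSum : ℕ → ℕ → List ℚ → ℚ
weightedSum m k []       = 0ℚ
weightedSum m k (b ∷ bs) = ((+ ((suc m) C k)) / 1) * b + weightedSum m (suc k) bs

bernoulliList : ℕ → List ℚ
bernoulliList zero    = [ 1ℚ ]
bernoulliList (suc m) =
  let bs = bernoulliList m in
  bs ++ [ - (((+ 1) / suc (suc m)) * weightedSum (suc m) 0 bs) ]

bernoulli : ℕ → ℚ
bernoulli n = fromMaybe 0ℚ (last (bernoulliList n))

-- ζ(1 - 2i) for i ≥ 1, via the classical formula ζ(1 - 2i) = - B_{2i} / (2i).
zetaOneMinusTwo : (i : ℕ) → .{{ℕ.NonZero i}} → ℚ
zetaOneMinusTwo (suc j) = - (bernoulli (2 ℕ.* suc j) * ((+ 1) / (2 ℕ.* suc j)))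

v : ℕ → ℚ
v zero    = 1ℚ
v (suc n) = v n * (∣ zetaOneMinusTwo (suc n) ∣ * ((+ 1) / 2))

module Submission where

-- Write B(x) = ∑ Bₙ xⁿ/n!. The recursion defining the Bernoulli numbers says B·(eˣ − 1) = x,
-- and since eˣ − 1 is cancellable this yields Euler's identity B² = (1 − x)·B − x·B′. For
-- β = B + x/2 (the even function (x/2)·coth(x/2)) it reads ∑ₖ C(n,k) βₖ βₙ₋ₖ = (1 − n)·βₙ for
-- n ≥ 3. Splitting this sum by parity shows that the odd βₙ vanish and that γₘ = (−1)ᵐ B₂ₘ
-- satisfies (2m+1)·γₘ = −∑_{0<i<m} C(2m,2i) γᵢ γₘ₋ᵢ. By strong induction every γₘ with m ≥ 1 is
-- ≤ 0, so all summands are ≥ 0, and keeping only i = 1 gives (2m+1)·|B₂ₘ| ≥ C(2m,2)·|B₂ₘ₋₂|/6,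
-- which propagates |B₂ₘ| ≥ 4m from m = 9 upwards. Hence each factor |ζ(1 − 2i)|/2 = |B₂ᵢ|/(4i)
-- of vₙ is ≥ 1 for i ≥ 9, so vₙ > 1 for all n ≥ 14 as v₁₄ > 1; the cases 6 ≤ n ≤ 13 are
-- computed from a verified table of B₀, …, B₂₈.

open import Defs
open import Data.Integer as ℤ using (+_)
import Data.Integer.Properties as ℤP
open import Data.List using (List; []; _∷_; _∷ʳ_; last; head; drop; applyUpTo)
open import Data.List.Properties using (applyUpTo-∷ʳ)
open import Data.Maybe using (just; fromMaybe)
open import Data.Nat as ℕ using (ℕ; zero; suc; _∸_; _≥_; z≤n; s≤s)
open import Data.Nat.Combinatorics using (_C_; nCk+nC[k+1]≡[n+1]C[k+1]; nCn≡1; nC1≡n; nCk≡nC[n∸k]; k>n⇒nCk≡0)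
open import Data.Nat.Induction using (<-rec)
import Data.Nat.Properties as ℕP
import Data.Nat.Tactic.RingSolver as ℕ-Solver
open import Data.Rational hiding (_≥_)
open import Data.Rational.Properties
open import Algebra.Properties.Group +-0-group using ()
  renaming (identityˡ-unique to +-identityˡ-unique; x∙y⁻¹≈ε⇒x≈y to x-y≡0⇒x≡y; ⁻¹-involutive to neg-involutive)
import Data.Rational.Unnormalised as ℚᵘ
import Data.Rational.Unnormalised.Properties as ℚᵘP
open import Data.Sum using (_⊎_; inj₁; inj₂)
open import Function using (_∘_)
open import Level using (0ℓ)
open import Relation.Binary.PropositionalEquality
open import Relation.Nullary.Decidable using (yes; no; toWitness; ¬?; _→-dec_; dec⇒maybe)
import Tactic.RingSolver.Core.AlmostCommutativeRing as ACR
open import Tactic.RingSolver using (solve-∀)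

ℚ-ring : ACR.AlmostCommutativeRing 0ℓ 0ℓ
ℚ-ring = ACR.fromCommutativeRing +-*-commutativeRing (λ x → dec⇒maybe (0ℚ ≟ x))

+-interchange : ∀ p q r s → p + q + (r + s) ≡ p + r + (q + s)
+-interchange = solve-∀ ℚ-ring

*-nonNeg : ∀ {p q} → 0ℚ ≤ p → 0ℚ ≤ q → 0ℚ ≤ p * q
*-nonNeg {p} {q} p≥0 q≥0 =
  nonNegative⁻¹ (p * q) {{nonNeg*nonNeg⇒nonNeg p {{nonNegative p≥0}} q {{nonNegative q≥0}}}}

*-nonPos : ∀ {p q} → p ≤ 0ℚ → q ≤ 0ℚ → 0ℚ ≤ p * q
*-nonPos {p} {q} p≤0 q≤0 =
  nonNegative⁻¹ (p * q) {{nonPos*nonPos⇒nonPos p {{nonPositive p≤0}} q {{nonPositive q≤0}}}}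

[1+n]Cn≡1+n : ∀ n → suc n C n ≡ suc n
[1+n]Cn≡1+n n = trans (nCk≡nC[n∸k] (ℕP.n≤1+n n))
  (trans (cong (suc n C_) (ℕP.m+n∸n≡m 1 n)) (nC1≡n (suc n)))

2*[1+n]C2 : ∀ n → 2 ℕ.* (suc n C 2) ≡ suc n ℕ.* n
2*[1+n]C2 zero    = refl
2*[1+n]C2 (suc n) = begin
  2 ℕ.* (suc (suc n) C 2)                   ≡⟨ cong (2 ℕ.*_) (nCk+nC[k+1]≡[n+1]C[k+1] (suc n) 1) ⟨
  2 ℕ.* (suc n C 1 ℕ.+ suc n C 2)           ≡⟨ cong (λ c → 2 ℕ.* (c ℕ.+ suc n C 2)) (nC1≡n (suc n)) ⟩
  2 ℕ.* (suc n ℕ.+ suc n C 2)               ≡⟨ ℕP.*-distribˡ-+ 2 (suc n) (suc n C 2) ⟩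
  2 ℕ.* suc n ℕ.+ 2 ℕ.* (suc n C 2)         ≡⟨ cong (2 ℕ.* suc n ℕ.+_) (2*[1+n]C2 n) ⟩
  2 ℕ.* suc n ℕ.+ suc n ℕ.* n               ≡⟨ factor n ⟩
  suc (suc n) ℕ.* suc n                     ∎
  where
  open ≡-Reasoning
  factor : ∀ n → 2 ℕ.* suc n ℕ.+ suc n ℕ.* n ≡ suc (suc n) ℕ.* suc n
  factor = ℕ-Solver.solve-∀

odd∸even : ∀ m {i} → i ℕ.≤ m → suc (2 ℕ.* m) ∸ 2 ℕ.* i ≡ suc (2 ℕ.* (m ∸ i))
odd∸even m {i} i≤m =
  trans (ℕP.+-∸-assoc 1 (ℕP.*-monoʳ-≤ 2 i≤m)) (cong suc (sym (ℕP.*-distribˡ-∸ 2 m i)))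

fromℕ : ℕ → ℚ
fromℕ k = + k / 1

private
  fromℕ≃mkℚᵘ : ∀ k → toℚᵘ (fromℕ k) ℚᵘ.≃ ℚᵘ.mkℚᵘ (+ k) 0
  fromℕ≃mkℚᵘ k = toℚᵘ-fromℚᵘ (ℚᵘ.mkℚᵘ (+ k) 0)

fromℕ-homo-+ : ∀ a b → fromℕ (a ℕ.+ b) ≡ fromℕ a + fromℕ b
fromℕ-homo-+ a b = toℚᵘ-injective (begin
  toℚᵘ (fromℕ (a ℕ.+ b))                   ≈⟨ fromℕ≃mkℚᵘ (a ℕ.+ b) ⟩
  ℚᵘ.mkℚᵘ (+ (a ℕ.+ b)) 0                   ≈⟨ ℚᵘ.*≡* denominator-free ⟩
  ℚᵘ.mkℚᵘ (+ a) 0 ℚᵘ.+ ℚᵘ.mkℚᵘ (+ b) 0      ≈⟨ ℚᵘP.+-cong (fromℕ≃mkℚᵘ a) (fromℕ≃mkℚᵘ b) ⟨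
  toℚᵘ (fromℕ a) ℚᵘ.+ toℚᵘ (fromℕ b)        ≈⟨ toℚᵘ-homo-+ (fromℕ a) (fromℕ b) ⟨
  toℚᵘ (fromℕ a + fromℕ b)                  ∎)
  where
  open ℚᵘP.≃-Reasoning
  denominator-free : + (a ℕ.+ b) ℤ.* + 1 ≡ (+ a ℤ.* + 1 ℤ.+ + b ℤ.* + 1) ℤ.* + 1
  denominator-free = cong (ℤ._* + 1) (trans (ℤP.pos-+ a b)
    (sym (cong₂ ℤ._+_ (ℤP.*-identityʳ (+ a)) (ℤP.*-identityʳ (+ b)))))

fromℕ-homo-* : ∀ a b → fromℕ (a ℕ.* b) ≡ fromℕ a * fromℕ b
fromℕ-homo-* a b = toℚᵘ-injective (begin
  toℚᵘ (fromℕ (a ℕ.* b))                   ≈⟨ fromℕ≃mkℚᵘ (a ℕ.* b) ⟩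
  ℚᵘ.mkℚᵘ (+ (a ℕ.* b)) 0                   ≈⟨ ℚᵘ.*≡* (cong (ℤ._* + 1) (ℤP.pos-* a b)) ⟩
  ℚᵘ.mkℚᵘ (+ a) 0 ℚᵘ.* ℚᵘ.mkℚᵘ (+ b) 0      ≈⟨ ℚᵘP.*-cong (fromℕ≃mkℚᵘ a) (fromℕ≃mkℚᵘ b) ⟨
  toℚᵘ (fromℕ a) ℚᵘ.* toℚᵘ (fromℕ b)        ≈⟨ toℚᵘ-homo-* (fromℕ a) (fromℕ b) ⟨
  toℚᵘ (fromℕ a * fromℕ b)                  ∎)
  where open ℚᵘP.≃-Reasoning

fromℕ-*-inverse : ∀ n .{{_ : ℕ.NonZero n}} → fromℕ n * (+ 1 / n) ≡ 1ℚ
fromℕ-*-inverse (suc k) = toℚᵘ-injective (begin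
  toℚᵘ (fromℕ (suc k) * (+ 1 / suc k))                   ≈⟨ toℚᵘ-homo-* (fromℕ (suc k)) (+ 1 / suc k) ⟩
  toℚᵘ (fromℕ (suc k)) ℚᵘ.* toℚᵘ (+ 1 / suc k)           ≈⟨ ℚᵘP.*-cong (fromℕ≃mkℚᵘ (suc k)) (toℚᵘ-fromℚᵘ (ℚᵘ.mkℚᵘ (+ 1) k)) ⟩
  ℚᵘ.mkℚᵘ (+ suc k) 0 ℚᵘ.* ℚᵘ.mkℚᵘ (+ 1) k               ≈⟨ ℚᵘP.*-inverseʳ (ℚᵘ.mkℚᵘ (+ suc k) 0) ⟩
  toℚᵘ 1ℚ                                               ∎)
  where open ℚᵘP.≃-Reasoning

fromℕ-mono-≤ : ∀ {a b} → a ℕ.≤ b → fromℕ a ≤ fromℕ b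
fromℕ-mono-≤ {a} {b} a≤b = toℚᵘ-cancel-≤ (begin
  toℚᵘ (fromℕ a)       ≃⟨ fromℕ≃mkℚᵘ a ⟩
  ℚᵘ.mkℚᵘ (+ a) 0      ≤⟨ ℚᵘ.*≤* (ℤP.*-monoʳ-≤-nonNeg (+ 1) (ℤ.+≤+ a≤b)) ⟩
  ℚᵘ.mkℚᵘ (+ b) 0      ≃⟨ fromℕ≃mkℚᵘ b ⟨
  toℚᵘ (fromℕ b)       ∎)
  where open ℚᵘP.≤-Reasoning

fromℕ-nonNeg : ∀ k → 0ℚ ≤ fromℕ k
fromℕ-nonNeg k = fromℕ-mono-≤ {0} {k} z≤n

fromℕ-pos : ∀ k → 0ℚ < fromℕ (suc k)
fromℕ-pos k = toℚᵘ-cancel-< (begin-strict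
  0ℚᵘ                    <⟨ ℚᵘ.*<* (ℤ.+<+ (s≤s z≤n)) ⟩
  ℚᵘ.mkℚᵘ (+ suc k) 0    ≃⟨ fromℕ≃mkℚᵘ (suc k) ⟨
  toℚᵘ (fromℕ (suc k))   ∎)
  where open ℚᵘP.≤-Reasoning; open ℚᵘ using (0ℚᵘ)

fromℕ[1+n]*q≡0⇒q≡0 : ∀ n q → fromℕ (suc n) * q ≡ 0ℚ → q ≡ 0ℚ
fromℕ[1+n]*q≡0⇒q≡0 n q nq≡0 = begin
  q                                        ≡⟨ *-identityˡ q ⟨
  1ℚ * q                                   ≡⟨ cong (_* q) (fromℕ-*-inverse (suc n)) ⟨
  fromℕ (suc n) * r * q                    ≡⟨ cong (_* q) (*-comm (fromℕ (suc n)) r) ⟩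
  r * fromℕ (suc n) * q                    ≡⟨ *-assoc r (fromℕ (suc n)) q ⟩
  r * (fromℕ (suc n) * q)                  ≡⟨ cong (r *_) nq≡0 ⟩
  r * 0ℚ                                   ≡⟨ *-zeroʳ r ⟩
  0ℚ                                       ∎
  where
  open ≡-Reasoning
  r = + 1 / suc n

∑< : ℕ → (ℕ → ℚ) → ℚ
∑< zero    f = 0ℚ
∑< (suc n) f = ∑< n f + f n

syntax ∑< n (λ k → e) = ∑[ k < n ] e

∑-cong : ∀ n {f g : ℕ → ℚ} → (∀ {k} → k ℕ.< n → f k ≡ g k) → ∑< n f ≡ ∑< n g
∑-cong zero    f≡g = refl
∑-cong (suc n) f≡g = cong₂ _+_ (∑-cong n (f≡g ∘ ℕP.m<n⇒m<1+n)) (f≡g ℕP.≤-refl)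

∑-zero : ∀ n {f : ℕ → ℚ} → (∀ {k} → k ℕ.< n → f k ≡ 0ℚ) → ∑< n f ≡ 0ℚ
∑-zero zero    f≡0 = refl
∑-zero (suc n) f≡0 = trans (cong₂ _+_ (∑-zero n (f≡0 ∘ ℕP.m<n⇒m<1+n)) (f≡0 ℕP.≤-refl)) (+-identityʳ 0ℚ)

∑-distrib-+ : ∀ n (f g : ℕ → ℚ) → ∑[ k < n ] (f k + g k) ≡ ∑< n f + ∑< n g
∑-distrib-+ zero    f g = refl
∑-distrib-+ (suc n) f g =
  trans (cong (_+ (f n + g n)) (∑-distrib-+ n f g)) (+-interchange (∑< n f) (∑< n g) (f n) (g n))

∑-distribˡ-* : ∀ n c (f : ℕ → ℚ) → ∑[ k < n ] (c * f k) ≡ c * ∑< n f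
∑-distribˡ-* zero    c f = sym (*-zeroʳ c)
∑-distribˡ-* (suc n) c f = trans (cong (_+ c * f n) (∑-distribˡ-* n c f)) (sym (*-distribˡ-+ c _ _))

∑-head : ∀ n (f : ℕ → ℚ) → ∑< (suc n) f ≡ f 0 + ∑[ k < n ] f (suc k)
∑-head zero    f = trans (+-identityˡ (f 0)) (sym (+-identityʳ (f 0)))
∑-head (suc n) f = trans (cong (_+ f (suc n)) (∑-head n f)) (+-assoc (f 0) _ _)

∑-parity : ∀ m (f : ℕ → ℚ) → ∑< (2 ℕ.* m) f ≡ ∑[ i < m ] f (2 ℕ.* i) + ∑[ i < m ] f (suc (2 ℕ.* i))
∑-parity zero    f = sym (+-identityʳ 0ℚ)
∑-parity (suc m) f = begin
  ∑< (2 ℕ.* suc m) f                            ≡⟨ cong (λ k → ∑< k f) (ℕP.*-suc 2 m) ⟩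
  ∑< (2 ℕ.* m) f + f (2 ℕ.* m) + f (suc (2 ℕ.* m))  ≡⟨ cong (λ s → s + f (2 ℕ.* m) + f (suc (2 ℕ.* m))) (∑-parity m f) ⟩
  E + O + f (2 ℕ.* m) + f (suc (2 ℕ.* m))       ≡⟨ regroup E O (f (2 ℕ.* m)) (f (suc (2 ℕ.* m))) ⟩
  (E + f (2 ℕ.* m)) + (O + f (suc (2 ℕ.* m)))   ∎
  where
  open ≡-Reasoning
  E = ∑[ i < m ] f (2 ℕ.* i)
  O = ∑[ i < m ] f (suc (2 ℕ.* i))
  regroup : ∀ p q r s → p + q + r + s ≡ (p + r) + (q + s)
  regroup = solve-∀ ℚ-ring

∑-nonNeg : ∀ n {f : ℕ → ℚ} → (∀ {k} → k ℕ.< n → 0ℚ ≤ f k) → 0ℚ ≤ ∑< n f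
∑-nonNeg zero    f≥0 = ≤-refl
∑-nonNeg (suc n) f≥0 = +-mono-≤ (∑-nonNeg n (f≥0 ∘ ℕP.m<n⇒m<1+n)) (f≥0 ℕP.≤-refl)

∑-head-≤ : ∀ n {f : ℕ → ℚ} → (∀ {k} → k ℕ.< suc n → 0ℚ ≤ f k) → f 0 ≤ ∑< (suc n) f
∑-head-≤ n {f} f≥0 = begin
  f 0                           ≡⟨ +-identityʳ (f 0) ⟨
  f 0 + 0ℚ                      ≤⟨ +-monoʳ-≤ (f 0) (∑-nonNeg n (f≥0 ∘ s≤s)) ⟩
  f 0 + ∑[ k < n ] f (suc k)    ≡⟨ ∑-head n f ⟨
  ∑< (suc n) f                  ∎
  where open ≤-Reasoning

-- Exponential generating functions

-- a n is the coefficient of xⁿ/n!, so ∂ is differentiation, and the product _⊛_ is defined by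
-- the Leibniz rule.
Series : Set
Series = ℕ → ℚ

∂ : Series → Series
∂ a k = a (suc k)

infixr 8 _·_
infixl 7 _⊛_
infixl 6 _⊕_ _⊖_

_⊛_ : Series → Series → Series
(a ⊛ b) zero    = a 0 * b 0
(a ⊛ b) (suc n) = (∂ a ⊛ b) n + (a ⊛ ∂ b) n

_⊕_ _⊖_ : Series → Series → Series
(a ⊕ b) n = a n + b n
(a ⊖ b) n = a n - b n

_·_ : ℚ → Series → Series
(c · a) n = c * a n

𝟘 𝟙 𝕩 exp : Series
𝟘 _       = 0ℚ
𝟙 zero    = 1ℚ
𝟙 (suc _) = 0ℚ
𝕩 zero    = 0ℚ
𝕩 (suc k) = 𝟙 k
exp _     = 1ℚ

⊛-comm : ∀ a b → a ⊛ b ≗ b ⊛ a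
⊛-comm a b zero    = *-comm (a 0) (b 0)
⊛-comm a b (suc n) = trans (cong₂ _+_ (⊛-comm (∂ a) b n) (⊛-comm a (∂ b) n)) (+-comm ((b ⊛ ∂ a) n) _)

⊛-congˡ : ∀ {a a'} b → a ≗ a' → a ⊛ b ≗ a' ⊛ b
⊛-congˡ b a≗a' zero    = cong (_* b 0) (a≗a' 0)
⊛-congˡ b a≗a' (suc n) = cong₂ _+_ (⊛-congˡ b (a≗a' ∘ suc) n) (⊛-congˡ (∂ b) a≗a' n)

⊛-congʳ : ∀ a {b b'} → b ≗ b' → a ⊛ b ≗ a ⊛ b'
⊛-congʳ a {b} {b'} b≗b' n =
  trans (⊛-comm a b n) (trans (⊛-congˡ a b≗b' n) (⊛-comm b' a n))

⊛-zeroˡ : ∀ b → 𝟘 ⊛ b ≗ 𝟘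
⊛-zeroˡ b zero    = *-zeroˡ (b 0)
⊛-zeroˡ b (suc n) = trans (cong₂ _+_ (⊛-zeroˡ b n) (⊛-zeroˡ (∂ b) n)) (+-identityʳ 0ℚ)

⊛-identityˡ : ∀ a → 𝟙 ⊛ a ≗ a
⊛-identityˡ a zero    = *-identityˡ (a 0)
⊛-identityˡ a (suc n) = trans (cong₂ _+_ (⊛-zeroˡ a n) (⊛-identityˡ (∂ a) n)) (+-identityˡ (a (suc n)))

⊛-distribʳ-⊕ : ∀ a a' b → (a ⊕ a') ⊛ b ≗ a ⊛ b ⊕ a' ⊛ b
⊛-distribʳ-⊕ a a' b zero    = *-distribʳ-+ (b 0) (a 0) (a' 0)
⊛-distribʳ-⊕ a a' b (suc n) =
  trans (cong₂ _+_ (⊛-distribʳ-⊕ (∂ a) (∂ a') b n) (⊛-distribʳ-⊕ a a' (∂ b) n))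
        (+-interchange ((∂ a ⊛ b) n) ((∂ a' ⊛ b) n) ((a ⊛ ∂ b) n) ((a' ⊛ ∂ b) n))

⊛-distribˡ-⊕ : ∀ a b b' → a ⊛ (b ⊕ b') ≗ a ⊛ b ⊕ a ⊛ b'
⊛-distribˡ-⊕ a b b' n = trans (⊛-comm a (b ⊕ b') n)
  (trans (⊛-distribʳ-⊕ b b' a n) (cong₂ _+_ (⊛-comm b a n) (⊛-comm b' a n)))

⊛-distribʳ-⊖ : ∀ a a' b → (a ⊖ a') ⊛ b ≗ a ⊛ b ⊖ a' ⊛ b
⊛-distribʳ-⊖ a a' b zero    = distrib (a 0) (a' 0) (b 0)
  where
  distrib : ∀ p q r → (p - q) * r ≡ p * r - q * r
  distrib = solve-∀ ℚ-ring
⊛-distribʳ-⊖ a a' b (suc n) =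
  trans (cong₂ _+_ (⊛-distribʳ-⊖ (∂ a) (∂ a') b n) (⊛-distribʳ-⊖ a a' (∂ b) n))
        (interchange ((∂ a ⊛ b) n) ((∂ a' ⊛ b) n) ((a ⊛ ∂ b) n) ((a' ⊛ ∂ b) n))
  where
  interchange : ∀ p q r s → p - q + (r - s) ≡ p + r - (q + s)
  interchange = solve-∀ ℚ-ring

⊛-distribˡ-⊖ : ∀ a b b' → a ⊛ (b ⊖ b') ≗ a ⊛ b ⊖ a ⊛ b'
⊛-distribˡ-⊖ a b b' n = trans (⊛-comm a (b ⊖ b') n)
  (trans (⊛-distribʳ-⊖ b b' a n) (cong₂ _-_ (⊛-comm b a n) (⊛-comm b' a n)))

⊛-scaleˡ : ∀ c a b → (c · a) ⊛ b ≗ c · (a ⊛ b)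
⊛-scaleˡ c a b zero    = *-assoc c (a 0) (b 0)
⊛-scaleˡ c a b (suc n) =
  trans (cong₂ _+_ (⊛-scaleˡ c (∂ a) b n) (⊛-scaleˡ c a (∂ b) n)) (sym (*-distribˡ-+ c _ _))

⊛-scaleʳ : ∀ c a b → a ⊛ (c · b) ≗ c · (a ⊛ b)
⊛-scaleʳ c a b n =
  trans (⊛-comm a (c · b) n) (trans (⊛-scaleˡ c b a n) (cong (c *_) (⊛-comm b a n)))

⊛-assoc : ∀ a b c → (a ⊛ b) ⊛ c ≗ a ⊛ (b ⊛ c)
⊛-assoc a b c zero    = *-assoc (a 0) (b 0) (c 0)
⊛-assoc a b c (suc n) = begin
  ((∂ a ⊛ b ⊕ a ⊛ ∂ b) ⊛ c) n + ((a ⊛ b) ⊛ ∂ c) n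
    ≡⟨ cong (_+ ((a ⊛ b) ⊛ ∂ c) n) (⊛-distribʳ-⊕ (∂ a ⊛ b) (a ⊛ ∂ b) c n) ⟩
  ((∂ a ⊛ b) ⊛ c) n + ((a ⊛ ∂ b) ⊛ c) n + ((a ⊛ b) ⊛ ∂ c) n
    ≡⟨ cong₂ _+_ (cong₂ _+_ (⊛-assoc (∂ a) b c n) (⊛-assoc a (∂ b) c n)) (⊛-assoc a b (∂ c) n) ⟩
  (∂ a ⊛ (b ⊛ c)) n + (a ⊛ (∂ b ⊛ c)) n + (a ⊛ (b ⊛ ∂ c)) n
    ≡⟨ +-assoc ((∂ a ⊛ (b ⊛ c)) n) _ _ ⟩
  (∂ a ⊛ (b ⊛ c)) n + ((a ⊛ (∂ b ⊛ c)) n + (a ⊛ (b ⊛ ∂ c)) n)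
    ≡⟨ cong (_+_ ((∂ a ⊛ (b ⊛ c)) n)) (⊛-distribˡ-⊕ a (∂ b ⊛ c) (b ⊛ ∂ c) n) ⟨
  (∂ a ⊛ (b ⊛ c)) n + (a ⊛ (∂ b ⊛ c ⊕ b ⊛ ∂ c)) n
    ∎
  where open ≡-Reasoning

𝕩⊛-suc : ∀ a n → (𝕩 ⊛ a) (suc n) ≡ fromℕ (suc n) * a n
𝕩⊛-suc a zero    = trans (cong₂ _+_ (*-identityˡ (a 0)) (*-zeroˡ (a 1)))
                         (trans (+-identityʳ (a 0)) (sym (*-identityˡ (a 0))))
𝕩⊛-suc a (suc n) = begin
  (𝟙 ⊛ a) (suc n) + (𝕩 ⊛ ∂ a) (suc n)        ≡⟨ cong₂ _+_ (⊛-identityˡ a (suc n)) (𝕩⊛-suc (∂ a) n) ⟩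
  a (suc n) + fromℕ (suc n) * a (suc n)      ≡⟨ cong (_+ fromℕ (suc n) * a (suc n)) (*-identityˡ (a (suc n))) ⟨
  1ℚ * a (suc n) + fromℕ (suc n) * a (suc n) ≡⟨ *-distribʳ-+ (a (suc n)) 1ℚ (fromℕ (suc n)) ⟨
  (1ℚ + fromℕ (suc n)) * a (suc n)           ≡⟨ cong (_* a (suc n)) (fromℕ-homo-+ 1 (suc n)) ⟨
  fromℕ (suc (suc n)) * a (suc n)            ∎
  where open ≡-Reasoning

binomialTerm : Series → Series → ℕ → ℕ → ℚ
binomialTerm a b n k = fromℕ (n C k) * (a k * b (n ∸ k))

binomialSum : Series → Series → Series
binomialSum a b n = ∑< (suc n) (binomialTerm a b n)

binomialSum-suc : ∀ a b n → binomialSum a b (suc n) ≡ binomialSum (∂ a) b n + binomialSum a (∂ b) n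
binomialSum-suc a b n = begin
  binomialSum a b (suc n)                           ≡⟨ ∑-head (suc n) term ⟩
  term 0 + ∑[ k < suc n ] term (suc k)              ≡⟨ cong (_+_ (term 0)) (∑-cong (suc n) pascal) ⟩
  term 0 + ∑[ k < suc n ] (left k + right k)        ≡⟨ cong (_+_ (term 0)) (∑-distrib-+ (suc n) left right) ⟩
  term 0 + (binomialSum (∂ a) b n + ∑< (suc n) right)
    ≡⟨ cong (λ s → term 0 + (binomialSum (∂ a) b n + s)) right-last ⟩
  term 0 + (binomialSum (∂ a) b n + ∑< n right)     ≡⟨ swap (term 0) (binomialSum (∂ a) b n) (∑< n right) ⟩
  binomialSum (∂ a) b n + (term 0 + ∑< n right)     ≡⟨ cong (_+_ (binomialSum (∂ a) b n)) sum-with-∂b ⟨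
  binomialSum (∂ a) b n + binomialSum a (∂ b) n     ∎
  where
  open ≡-Reasoning
  term = binomialTerm a b (suc n)
  left right : ℕ → ℚ
  left  k = fromℕ (n C k) * (a (suc k) * b (n ∸ k))
  right k = fromℕ (n C suc k) * (a (suc k) * b (n ∸ k))

  pascal : ∀ {k} → k ℕ.< suc n → term (suc k) ≡ left k + right k
  pascal {k} _ = begin
    fromℕ (suc n C suc k) * t                  ≡⟨ cong (λ c → fromℕ c * t) (nCk+nC[k+1]≡[n+1]C[k+1] n k) ⟨
    fromℕ (n C k ℕ.+ n C suc k) * t            ≡⟨ cong (_* t) (fromℕ-homo-+ (n C k) (n C suc k)) ⟩
    (fromℕ (n C k) + fromℕ (n C suc k)) * t    ≡⟨ *-distribʳ-+ t (fromℕ (n C k)) (fromℕ (n C suc k)) ⟩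
    left k + right k                           ∎
    where t = a (suc k) * b (n ∸ k)

  right-last : ∑< (suc n) right ≡ ∑< n right
  right-last = begin
    ∑< n right + fromℕ (n C suc n) * (a (suc n) * b (n ∸ n))
      ≡⟨ cong (λ c → ∑< n right + fromℕ c * (a (suc n) * b (n ∸ n))) (k>n⇒nCk≡0 {n} {suc n} ℕP.≤-refl) ⟩
    ∑< n right + 0ℚ * (a (suc n) * b (n ∸ n))  ≡⟨ cong (_+_ (∑< n right)) (*-zeroˡ (a (suc n) * b (n ∸ n))) ⟩
    ∑< n right + 0ℚ                            ≡⟨ +-identityʳ _ ⟩
    ∑< n right                                 ∎

  sum-with-∂b : binomialSum a (∂ b) n ≡ term 0 + ∑< n right
  sum-with-∂b = trans (∑-head n _) (cong (_+_ (term 0)) (∑-cong n λ {k} k<n →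
    cong (λ j → fromℕ (n C suc k) * (a (suc k) * b j)) (sym (ℕP.+-∸-assoc 1 k<n))))

  swap : ∀ p q r → p + (q + r) ≡ q + (p + r)
  swap = solve-∀ ℚ-ring

⊛-binomial : ∀ a b → a ⊛ b ≗ binomialSum a b
⊛-binomial a b zero    = sym (trans (+-identityˡ _) (*-identityˡ _))
⊛-binomial a b (suc n) =
  trans (cong₂ _+_ (⊛-binomial (∂ a) b n) (⊛-binomial a (∂ b) n)) (sym (binomialSum-suc a b n))

binomialTerm-zeroˡ : ∀ a b n {k} → a k ≡ 0ℚ → binomialTerm a b n k ≡ 0ℚ
binomialTerm-zeroˡ a b n {k} ak≡0 =
  trans (cong (λ x → fromℕ (n C k) * (x * b (n ∸ k))) ak≡0)
        (trans (cong (fromℕ (n C k) *_) (*-zeroˡ (b (n ∸ k)))) (*-zeroʳ (fromℕ (n C k))))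

binomialTerm-zeroʳ : ∀ a b n {k} → b (n ∸ k) ≡ 0ℚ → binomialTerm a b n k ≡ 0ℚ
binomialTerm-zeroʳ a b n {k} b≡0 =
  trans (cong (λ x → fromℕ (n C k) * (a k * x)) b≡0)
        (trans (cong (fromℕ (n C k) *_) (*-zeroʳ (a k))) (*-zeroʳ (fromℕ (n C k))))

binomialTerm-first : ∀ a b n → a 0 ≡ 1ℚ → binomialTerm a b n 0 ≡ b n
binomialTerm-first a b n a0≡1 =
  trans (*-identityˡ _) (trans (cong (_* b n) a0≡1) (*-identityˡ (b n)))

binomialTerm-last : ∀ a b n → b 0 ≡ 1ℚ → binomialTerm a b n n ≡ a n
binomialTerm-last a b n b0≡1 = begin
  fromℕ (n C n) * (a n * b (n ∸ n))   ≡⟨ cong₂ (λ c k → fromℕ c * (a n * b k)) (nCn≡1 n) (ℕP.n∸n≡0 n) ⟩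
  1ℚ * (a n * b 0)                    ≡⟨ *-identityˡ _ ⟩
  a n * b 0                           ≡⟨ cong (a n *_) b0≡1 ⟩
  a n * 1ℚ                            ≡⟨ *-identityʳ (a n) ⟩
  a n                                 ∎
  where open ≡-Reasoning

⊛exp-fixed⇒𝟘 : ∀ h → h ⊛ exp ≗ h → h ≗ 𝟘
⊛exp-fixed⇒𝟘 h fixed = <-rec (λ n → h n ≡ 0ℚ) step
  where
  step : ∀ n → (∀ {k} → k ℕ.< n → h k ≡ 0ℚ) → h n ≡ 0ℚ
  step n h<n≡0 = fromℕ[1+n]*q≡0⇒q≡0 n (h n) (begin
    fromℕ (suc n) * h n          ≡⟨ +-identityˡ _ ⟨
    0ℚ + fromℕ (suc n) * h n     ≡⟨ cong₂ _+_ lower-terms next-to-top ⟨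
    ∑< (suc n) T                 ≡⟨ +-identityˡ-unique (∑< (suc n) T) (T (suc n)) all-terms ⟩
    0ℚ                           ∎)
    where
    open ≡-Reasoning
    T = binomialTerm h exp (suc n)
    lower-terms : ∑< n T ≡ 0ℚ
    lower-terms = ∑-zero n λ {k} k<n → binomialTerm-zeroˡ h exp (suc n) {k} (h<n≡0 k<n)
    next-to-top : T n ≡ fromℕ (suc n) * h n
    next-to-top = cong₂ (λ c x → fromℕ c * x) ([1+n]Cn≡1+n n) (*-identityʳ (h n))
    all-terms : ∑< (suc n) T + T (suc n) ≡ T (suc n)
    all-terms = begin
      ∑< (suc (suc n)) T    ≡⟨ ⊛-binomial h exp (suc n) ⟨
      (h ⊛ exp) (suc n)     ≡⟨ fixed (suc n) ⟩
      h (suc n)             ≡⟨ binomialTerm-last h exp (suc n) refl ⟨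
      T (suc n)             ∎

-- The generating function of the Bernoulli numbers

B : Series
B = bernoulli

nextBernoulli : ℕ → List ℚ → ℚ
nextBernoulli m bs = - (+ 1 / suc (suc m) * weightedSum (suc m) 0 bs)

last-∷ʳ : ∀ (xs : List ℚ) x → last (xs ∷ʳ x) ≡ just x
last-∷ʳ []           x = refl
last-∷ʳ (_ ∷ [])     x = refl
last-∷ʳ (_ ∷ y ∷ xs) x = last-∷ʳ (y ∷ xs) x

last-applyUpTo : ∀ (f : ℕ → ℚ) m → last (applyUpTo f (suc m)) ≡ just (f m)
last-applyUpTo f m = trans (cong last (sym (applyUpTo-∷ʳ f m))) (last-∷ʳ (applyUpTo f m) (f m))

bernoulli-suc : ∀ m → B (suc m) ≡ nextBernoulli m (bernoulliList m)
bernoulli-suc m = cong (fromMaybe 0ℚ) (last-∷ʳ (bernoulliList m) _)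

bernoulliList-applyUpTo : ∀ m → bernoulliList m ≡ applyUpTo B (suc m)
bernoulliList-applyUpTo zero    = refl
bernoulliList-applyUpTo (suc m) =
  trans (cong₂ _∷ʳ_ (bernoulliList-applyUpTo m) (sym (bernoulli-suc m))) (applyUpTo-∷ʳ B (suc m))

bernoulli-characterisation :
  ∀ (f : ℕ → ℚ) N → f 0 ≡ 1ℚ →
  (∀ {m} → m ℕ.< N → nextBernoulli m (applyUpTo f (suc m)) ≡ f (suc m)) →
  ∀ {m} → m ℕ.≤ N → B m ≡ f m
bernoulli-characterisation f N f0≡1 f-next {m} m≤N =
  cong (fromMaybe 0ℚ) (trans (cong last (list-agrees m≤N)) (last-applyUpTo f m))
  where
  list-agrees : ∀ {m} → m ℕ.≤ N → bernoulliList m ≡ applyUpTo f (suc m)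
  list-agrees {zero}  _   = cong (_∷ []) (sym f0≡1)
  list-agrees {suc m} m<N = begin
    bernoulliList m ∷ʳ nextBernoulli m (bernoulliList m)
      ≡⟨ cong (λ bs → bs ∷ʳ nextBernoulli m bs) (list-agrees (ℕP.<⇒≤ m<N)) ⟩
    applyUpTo f (suc m) ∷ʳ nextBernoulli m (applyUpTo f (suc m))
      ≡⟨ cong (applyUpTo f (suc m) ∷ʳ_) (f-next m<N) ⟩
    applyUpTo f (suc m) ∷ʳ f (suc m)
      ≡⟨ applyUpTo-∷ʳ f (suc m) ⟩
    applyUpTo f (suc (suc m))
      ∎
    where open ≡-Reasoning

weightedSum-applyUpTo : ∀ m k (f : ℕ → ℚ) n →
  weightedSum m k (applyUpTo f n) ≡ ∑[ j < n ] (fromℕ (suc m C (k ℕ.+ j)) * f j)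
weightedSum-applyUpTo m k f zero    = refl
weightedSum-applyUpTo m k f (suc n) = begin
  fromℕ (suc m C k) * f 0 + weightedSum m (suc k) (applyUpTo (f ∘ suc) n)
    ≡⟨ cong₂ (λ i s → fromℕ (suc m C i) * f 0 + s) (sym (ℕP.+-identityʳ k))
             (trans (weightedSum-applyUpTo m (suc k) (f ∘ suc) n)
                    (∑-cong n λ {j} _ → cong (λ i → fromℕ (suc m C i) * f (suc j)) (sym (ℕP.+-suc k j)))) ⟩
  fromℕ (suc m C (k ℕ.+ 0)) * f 0 + ∑[ j < n ] (fromℕ (suc m C (k ℕ.+ suc j)) * f (suc j))
    ≡⟨ ∑-head n (λ j → fromℕ (suc m C (k ℕ.+ j)) * f j) ⟨
  ∑[ j < suc n ] (fromℕ (suc m C (k ℕ.+ j)) * f j)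
    ∎
  where open ≡-Reasoning

bernoulli-recurrence : ∀ m → ∑[ k < suc (suc m) ] (fromℕ (suc (suc m) C k) * B k) ≡ 0ℚ
bernoulli-recurrence m = begin
  W + fromℕ (N C suc m) * B (suc m)        ≡⟨ cong₂ (λ c b → W + fromℕ c * b) ([1+n]Cn≡1+n (suc m)) B-next ⟩
  W + fromℕ N * - (+ 1 / N * W)            ≡⟨ cong (_+_ W) N*-[W/N]≡-W ⟩
  W - W                                    ≡⟨ +-inverseʳ W ⟩
  0ℚ                                       ∎
  where
  open ≡-Reasoning
  N = suc (suc m)
  W = ∑[ k < suc m ] (fromℕ (N C k) * B k)
  B-next : B (suc m) ≡ - (+ 1 / N * W)
  B-next = begin
    B (suc m)                               ≡⟨ bernoulli-suc m ⟩
    nextBernoulli m (bernoulliList m)       ≡⟨ cong (nextBernoulli m) (bernoulliList-applyUpTo m) ⟩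
    nextBernoulli m (applyUpTo B (suc m))   ≡⟨ cong (λ s → - (+ 1 / N * s)) (weightedSum-applyUpTo (suc m) 0 B (suc m)) ⟩
    - (+ 1 / N * W)                         ∎
  N*-[W/N]≡-W : fromℕ N * - (+ 1 / N * W) ≡ - W
  N*-[W/N]≡-W = begin
    fromℕ N * - (+ 1 / N * W)     ≡⟨ neg-distribʳ-* (fromℕ N) (+ 1 / N * W) ⟨
    - (fromℕ N * (+ 1 / N * W))   ≡⟨ cong -_ (*-assoc (fromℕ N) (+ 1 / N) W) ⟨
    - (fromℕ N * (+ 1 / N) * W)   ≡⟨ cong (λ c → - (c * W)) (fromℕ-*-inverse N) ⟩
    - (1ℚ * W)                    ≡⟨ cong -_ (*-identityˡ W) ⟩
    - W                           ∎

B⊛exp : B ⊛ exp ≗ B ⊕ 𝕩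
B⊛exp zero          = refl
B⊛exp (suc zero)    = refl
B⊛exp (suc (suc m)) = begin
  (B ⊛ exp) N                                             ≡⟨ ⊛-binomial B exp N ⟩
  ∑[ k < suc N ] (fromℕ (N C k) * (B k * 1ℚ))             ≡⟨ ∑-cong (suc N) (λ {k} _ → cong (fromℕ (N C k) *_) (*-identityʳ (B k))) ⟩
  ∑[ k < N ] (fromℕ (N C k) * B k) + fromℕ (N C N) * B N  ≡⟨ cong₂ (λ s c → s + fromℕ c * B N) (bernoulli-recurrence m) (nCn≡1 N) ⟩
  0ℚ + 1ℚ * B N                                           ≡⟨ trans (+-identityˡ _) (*-identityˡ (B N)) ⟩
  B N                                                     ≡⟨ +-identityʳ (B N) ⟨
  B N + 0ℚ                                                ∎
  where
  open ≡-Reasoning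
  N = suc (suc m)

bernoulli-euler : B ⊛ B ≗ B ⊖ 𝕩 ⊛ ∂ B ⊖ 𝕩 ⊛ B
bernoulli-euler n = x-y≡0⇒x≡y ((B ⊛ B) n) (G n) (⊛exp-fixed⇒𝟘 (B ⊛ B ⊖ G) fixed n)
  where
  open ≡-Reasoning
  G : Series
  G = B ⊖ 𝕩 ⊛ ∂ B ⊖ 𝕩 ⊛ B

  ∂B⊛exp : ∂ B ⊛ exp ≗ ∂ B ⊕ 𝟙 ⊖ B ⊖ 𝕩
  ∂B⊛exp k = begin
    (∂ B ⊛ exp) k                         ≡⟨ add-sub ((∂ B ⊛ exp) k) ((B ⊛ exp) k) ⟩
    (B ⊛ exp) (suc k) - (B ⊛ exp) k       ≡⟨ cong₂ _-_ (B⊛exp (suc k)) (B⊛exp k) ⟩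
    B (suc k) + 𝟙 k - (B k + 𝕩 k)         ≡⟨ sub-sum (B (suc k) + 𝟙 k) (B k) (𝕩 k) ⟩
    B (suc k) + 𝟙 k - B k - 𝕩 k           ∎
    where
    add-sub : ∀ x y → x ≡ x + y - y
    add-sub = solve-∀ ℚ-ring
    sub-sum : ∀ x y z → x - (y + z) ≡ x - y - z
    sub-sum = solve-∀ ℚ-ring

  𝕩⊛∂B⊛exp : (𝕩 ⊛ ∂ B) ⊛ exp ≗ 𝕩 ⊛ ∂ B ⊕ 𝕩 ⊖ 𝕩 ⊛ B ⊖ 𝕩 ⊛ 𝕩
  𝕩⊛∂B⊛exp k = begin
    ((𝕩 ⊛ ∂ B) ⊛ exp) k                                         ≡⟨ ⊛-assoc 𝕩 (∂ B) exp k ⟩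
    (𝕩 ⊛ (∂ B ⊛ exp)) k                                         ≡⟨ ⊛-congʳ 𝕩 ∂B⊛exp k ⟩
    (𝕩 ⊛ (∂ B ⊕ 𝟙 ⊖ B ⊖ 𝕩)) k                                   ≡⟨ ⊛-distribˡ-⊖ 𝕩 (∂ B ⊕ 𝟙 ⊖ B) 𝕩 k ⟩
    (𝕩 ⊛ (∂ B ⊕ 𝟙 ⊖ B)) k - (𝕩 ⊛ 𝕩) k                           ≡⟨ cong (_- (𝕩 ⊛ 𝕩) k) (⊛-distribˡ-⊖ 𝕩 (∂ B ⊕ 𝟙) B k) ⟩
    (𝕩 ⊛ (∂ B ⊕ 𝟙)) k - (𝕩 ⊛ B) k - (𝕩 ⊛ 𝕩) k                   ≡⟨ cong (λ x → x - (𝕩 ⊛ B) k - (𝕩 ⊛ 𝕩) k) (⊛-distribˡ-⊕ 𝕩 (∂ B) 𝟙 k) ⟩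
    (𝕩 ⊛ ∂ B) k + (𝕩 ⊛ 𝟙) k - (𝕩 ⊛ B) k - (𝕩 ⊛ 𝕩) k             ≡⟨ cong (λ x → (𝕩 ⊛ ∂ B) k + x - (𝕩 ⊛ B) k - (𝕩 ⊛ 𝕩) k) 𝕩⊛𝟙 ⟩
    (𝕩 ⊛ ∂ B) k + 𝕩 k - (𝕩 ⊛ B) k - (𝕩 ⊛ 𝕩) k                   ∎
    where
    𝕩⊛𝟙 : (𝕩 ⊛ 𝟙) k ≡ 𝕩 k
    𝕩⊛𝟙 = trans (⊛-comm 𝕩 𝟙 k) (⊛-identityˡ 𝕩 k)

  a⊛B⊛exp : ∀ a → (a ⊛ B) ⊛ exp ≗ a ⊛ B ⊕ a ⊛ 𝕩
  a⊛B⊛exp a k = trans (⊛-assoc a B exp k) (trans (⊛-congʳ a B⊛exp k) (⊛-distribˡ-⊕ a B 𝕩 k))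

  G⊛exp : G ⊛ exp ≗ B ⊖ 𝕩 ⊛ ∂ B
  G⊛exp k = begin
    (G ⊛ exp) k                                                   ≡⟨ ⊛-distribʳ-⊖ (B ⊖ 𝕩 ⊛ ∂ B) (𝕩 ⊛ B) exp k ⟩
    ((B ⊖ 𝕩 ⊛ ∂ B) ⊛ exp) k - ((𝕩 ⊛ B) ⊛ exp) k                   ≡⟨ cong (_- ((𝕩 ⊛ B) ⊛ exp) k) (⊛-distribʳ-⊖ B (𝕩 ⊛ ∂ B) exp k) ⟩
    (B ⊛ exp) k - ((𝕩 ⊛ ∂ B) ⊛ exp) k - ((𝕩 ⊛ B) ⊛ exp) k
      ≡⟨ cong₂ _-_ (cong₂ _-_ (B⊛exp k) (𝕩⊛∂B⊛exp k)) (a⊛B⊛exp 𝕩 k) ⟩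
    B k + 𝕩 k - (xB' + 𝕩 k - xB - xx) - (xB + xx)                 ≡⟨ cancel (B k) (𝕩 k) xB' xB xx ⟩
    B k - xB'                                                     ∎
    where
    xB' = (𝕩 ⊛ ∂ B) k
    xB  = (𝕩 ⊛ B) k
    xx  = (𝕩 ⊛ 𝕩) k
    cancel : ∀ b x p q r → b + x - (p + x - q - r) - (q + r) ≡ b - p
    cancel = solve-∀ ℚ-ring

  fixed : (B ⊛ B ⊖ G) ⊛ exp ≗ B ⊛ B ⊖ G
  fixed k = begin
    ((B ⊛ B ⊖ G) ⊛ exp) k                                  ≡⟨ ⊛-distribʳ-⊖ (B ⊛ B) G exp k ⟩
    ((B ⊛ B) ⊛ exp) k - (G ⊛ exp) k                        ≡⟨ cong₂ _-_ (a⊛B⊛exp B k) (G⊛exp k) ⟩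
    (B ⊛ B) k + (B ⊛ 𝕩) k - (B k - (𝕩 ⊛ ∂ B) k)            ≡⟨ cong (λ x → (B ⊛ B) k + x - (B k - (𝕩 ⊛ ∂ B) k)) (⊛-comm B 𝕩 k) ⟩
    (B ⊛ B) k + (𝕩 ⊛ B) k - (B k - (𝕩 ⊛ ∂ B) k)            ≡⟨ regroup ((B ⊛ B) k) ((𝕩 ⊛ B) k) (B k) ((𝕩 ⊛ ∂ B) k) ⟩
    (B ⊛ B) k - (B k - (𝕩 ⊛ ∂ B) k - (𝕩 ⊛ B) k)            ∎
    where
    regroup : ∀ s x b p → s + x - (b - p) ≡ s - (b - p - x)
    regroup = solve-∀ ℚ-ring

β : Series
β = B ⊕ ½ · 𝕩

β≡B : ∀ {k} → 2 ℕ.≤ k → β k ≡ B k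
β≡B {k@(suc (suc _))} (s≤s (s≤s _)) = trans (cong (_+_ (B k)) (*-zeroʳ ½)) (+-identityʳ (B k))

β-euler : β ⊛ β ≗ B ⊖ 𝕩 ⊛ ∂ B ⊕ (½ * ½) · (𝕩 ⊛ 𝕩)
β-euler n = begin
  (β ⊛ β) n                                               ≡⟨ ⊛-distribʳ-⊕ B (½ · 𝕩) β n ⟩
  (B ⊛ β) n + ((½ · 𝕩) ⊛ β) n                             ≡⟨ cong₂ _+_ (⊛-distribˡ-⊕ B B (½ · 𝕩) n) (⊛-distribˡ-⊕ (½ · 𝕩) B (½ · 𝕩) n) ⟩
  (B ⊛ B) n + (B ⊛ ½ · 𝕩) n + (((½ · 𝕩) ⊛ B) n + ((½ · 𝕩) ⊛ (½ · 𝕩)) n)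
    ≡⟨ cong₂ (λ x y → x + y + (((½ · 𝕩) ⊛ B) n + ((½ · 𝕩) ⊛ (½ · 𝕩)) n)) (bernoulli-euler n) B⊛½𝕩 ⟩
  B n - xB' - xB + ½ * xB + (((½ · 𝕩) ⊛ B) n + ((½ · 𝕩) ⊛ (½ · 𝕩)) n)
    ≡⟨ cong (λ x → B n - xB' - xB + ½ * xB + x) (cong₂ _+_ (⊛-scaleˡ ½ 𝕩 B n) ½𝕩⊛½𝕩) ⟩
  B n - xB' - xB + ½ * xB + (½ * xB + ½ * (½ * xx))       ≡⟨ collect (B n) xB' xB xx ⟩
  B n - xB' + ½ * ½ * xx                                  ∎
  where
  open ≡-Reasoning
  xB' = (𝕩 ⊛ ∂ B) n
  xB  = (𝕩 ⊛ B) n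
  xx  = (𝕩 ⊛ 𝕩) n
  B⊛½𝕩 : (B ⊛ ½ · 𝕩) n ≡ ½ * xB
  B⊛½𝕩 = trans (⊛-scaleʳ ½ B 𝕩 n) (cong (½ *_) (⊛-comm B 𝕩 n))
  ½𝕩⊛½𝕩 : ((½ · 𝕩) ⊛ (½ · 𝕩)) n ≡ ½ * (½ * xx)
  ½𝕩⊛½𝕩 = trans (⊛-scaleˡ ½ 𝕩 (½ · 𝕩) n) (cong (½ *_) (⊛-scaleʳ ½ 𝕩 𝕩 n))
  collect : ∀ b p q r → b - p - q + ½ * q + (½ * q + ½ * (½ * r)) ≡ b - p + ½ * ½ * r
  collect = solve-∀ ℚ-ring

β⊛β≡[1-n]β : ∀ {n} → 3 ℕ.≤ n → (β ⊛ β) n ≡ β n - fromℕ n * β n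
β⊛β≡[1-n]β {n@(suc (suc (suc k)))} (s≤s (s≤s (s≤s _))) = begin
  (β ⊛ β) n                                        ≡⟨ β-euler n ⟩
  B n - (𝕩 ⊛ ∂ B) n + ½ * ½ * (𝕩 ⊛ 𝕩) n           ≡⟨ cong₂ (λ x y → B n - x + ½ * ½ * y) (𝕩⊛-suc (∂ B) (2 ℕ.+ k)) (𝕩⊛-suc 𝕩 (2 ℕ.+ k)) ⟩
  B n - fromℕ n * B n + ½ * ½ * (fromℕ n * 0ℚ)     ≡⟨ cong (λ x → B n - fromℕ n * B n + ½ * ½ * x) (*-zeroʳ (fromℕ n)) ⟩
  B n - fromℕ n * B n + ½ * ½ * 0ℚ                 ≡⟨ trans (cong (_+_ (B n - fromℕ n * B n)) (*-zeroʳ (½ * ½))) (+-identityʳ _) ⟩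
  B n - fromℕ n * B n                              ≡⟨ cong (λ x → x - fromℕ n * x) (β≡B {n} (s≤s (s≤s z≤n))) ⟨
  β n - fromℕ n * β n                              ∎
  where open ≡-Reasoning

β-odd : ∀ m → β (suc (2 ℕ.* m)) ≡ 0ℚ
β-odd = <-rec (λ m → β (suc (2 ℕ.* m)) ≡ 0ℚ) step
  where
  step : ∀ m → (∀ {i} → i ℕ.< m → β (suc (2 ℕ.* i)) ≡ 0ℚ) → β (suc (2 ℕ.* m)) ≡ 0ℚ
  step zero       _        = refl
  step m@(suc m') β-odd<m = fromℕ[1+n]*q≡0⇒q≡0 n y (begin
    fromℕ (suc n) * y             ≡⟨ cong (_* y) (fromℕ-homo-+ 1 n) ⟩
    (1ℚ + fromℕ n) * y            ≡⟨ rearrange y (fromℕ n) ⟩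
    y + y - (y - fromℕ n * y)     ≡⟨ cong (_- (y - fromℕ n * y)) square ⟨
    (β ⊛ β) n - (y - fromℕ n * y) ≡⟨ cong (_- (y - fromℕ n * y)) (β⊛β≡[1-n]β {n} (s≤s (ℕP.*-monoʳ-≤ 2 (s≤s z≤n)))) ⟩
    (y - fromℕ n * y) - (y - fromℕ n * y) ≡⟨ +-inverseʳ (y - fromℕ n * y) ⟩
    0ℚ                            ∎)
    where
    open ≡-Reasoning
    n = suc (2 ℕ.* m)
    y = β n
    T = binomialTerm β β n
    rearrange : ∀ y x → (1ℚ + x) * y ≡ y + y - (y - x * y)
    rearrange = solve-∀ ℚ-ring
    evens : ∑[ i < suc m ] T (2 ℕ.* i) ≡ y
    evens = begin
      ∑[ i < suc m ] T (2 ℕ.* i)           ≡⟨ ∑-head m (λ i → T (2 ℕ.* i)) ⟩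
      T 0 + ∑[ i < m ] T (2 ℕ.* suc i)     ≡⟨ cong₂ _+_ (binomialTerm-first β β n refl) (∑-zero m λ {i} i<m →
          binomialTerm-zeroʳ β β n {2 ℕ.* suc i} (trans (cong β (odd∸even m i<m))
            (β-odd<m (ℕP.∸-monoʳ-< {o = 0} (s≤s z≤n) i<m)))) ⟩
      y + 0ℚ                              ≡⟨ +-identityʳ y ⟩
      y                                   ∎
    odds : ∑[ i < suc m ] T (suc (2 ℕ.* i)) ≡ y
    odds = begin
      ∑[ i < m ] T (suc (2 ℕ.* i)) + T n  ≡⟨ cong₂ _+_ (∑-zero m λ {i} i<m → binomialTerm-zeroˡ β β n {suc (2 ℕ.* i)} (β-odd<m i<m))
                                                     (binomialTerm-last β β n refl) ⟩
      0ℚ + y                              ≡⟨ +-identityˡ y ⟩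
      y                                   ∎
    square : (β ⊛ β) n ≡ y + y
    square = begin
      (β ⊛ β) n                           ≡⟨ ⊛-binomial β β n ⟩
      ∑< (suc n) T                        ≡⟨ cong (λ k → ∑< k T) (ℕP.*-suc 2 m) ⟨
      ∑< (2 ℕ.* suc m) T                  ≡⟨ ∑-parity (suc m) T ⟩
      ∑[ i < suc m ] T (2 ℕ.* i) + ∑[ i < suc m ] T (suc (2 ℕ.* i))  ≡⟨ cong₂ _+_ evens odds ⟩
      y + y                               ∎

β⊛β-even : ∀ m → (β ⊛ β) (2 ℕ.* m) ≡ ∑[ i < suc m ] (fromℕ (2 ℕ.* m C 2 ℕ.* i) * (β (2 ℕ.* i) * β (2 ℕ.* (m ∸ i))))
β⊛β-even m = begin
  (β ⊛ β) n                                                          ≡⟨ ⊛-binomial β β n ⟩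
  ∑< n T + T n                                                       ≡⟨ cong (_+ T n) (∑-parity m T) ⟩
  ∑[ i < m ] T (2 ℕ.* i) + ∑[ i < m ] T (suc (2 ℕ.* i)) + T n        ≡⟨ cong (λ s → ∑[ i < m ] T (2 ℕ.* i) + s + T n)
                                                                          (∑-zero m λ {i} _ → binomialTerm-zeroˡ β β n {suc (2 ℕ.* i)} (β-odd i)) ⟩
  ∑[ i < m ] T (2 ℕ.* i) + 0ℚ + T n                                  ≡⟨ cong (_+ T n) (+-identityʳ (∑[ i < m ] T (2 ℕ.* i))) ⟩
  ∑[ i < suc m ] T (2 ℕ.* i)                                         ≡⟨ ∑-cong (suc m) (λ {i} _ →
                                                                          cong (λ k → fromℕ (n C 2 ℕ.* i) * (β (2 ℕ.* i) * β k)) (sym (ℕP.*-distribˡ-∸ 2 m i))) ⟩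
  ∑[ i < suc m ] (fromℕ (n C 2 ℕ.* i) * (β (2 ℕ.* i) * β (2 ℕ.* (m ∸ i))))  ∎
  where
  open ≡-Reasoning
  n = 2 ℕ.* m
  T = binomialTerm β β n

-- Sign and growth of B₂ₘ

-1^_ : ℕ → ℚ
-1^ zero  = 1ℚ
-1^ suc i = - (-1^ i)

-1^-homo-+ : ∀ a b → -1^ (a ℕ.+ b) ≡ -1^ a * -1^ b
-1^-homo-+ zero    b = sym (*-identityˡ (-1^ b))
-1^-homo-+ (suc a) b = trans (cong -_ (-1^-homo-+ a b)) (neg-distribˡ-* (-1^ a) (-1^ b))

∣-1^∣ : ∀ i → ∣ -1^ i ∣ ≡ 1ℚ
∣-1^∣ zero    = refl
∣-1^∣ (suc i) = trans (∣-p∣≡∣p∣ (-1^ i)) (∣-1^∣ i)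

γ : Series
γ i = -1^ i * β (2 ℕ.* i)

γ-term : ℕ → ℕ → ℚ
γ-term m i = fromℕ (2 ℕ.* m C 2 ℕ.* i) * (γ i * γ (m ∸ i))

γ-recurrence : ∀ p → let m = 2 ℕ.+ p in
  fromℕ (suc (2 ℕ.* m)) * γ m ≡ - ∑[ j < suc p ] γ-term m (suc j)
γ-recurrence p = begin
  fromℕ (suc (2 ℕ.* m)) * y              ≡⟨ cong (_* y) (fromℕ-homo-+ 1 (2 ℕ.* m)) ⟩
  (1ℚ + fromℕ (2 ℕ.* m)) * y             ≡⟨ rearrange y (fromℕ (2 ℕ.* m)) S ⟩
  y + (S + y) - (y - fromℕ (2 ℕ.* m) * y) - S
    ≡⟨ cong (λ z → z - (y - fromℕ (2 ℕ.* m) * y) - S) split ⟩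
  ∑[ i < suc m ] γ-term m i - (y - fromℕ (2 ℕ.* m) * y) - S
    ≡⟨ cong (λ z → z - (y - fromℕ (2 ℕ.* m) * y) - S) signed-square ⟩
  y - fromℕ (2 ℕ.* m) * y - (y - fromℕ (2 ℕ.* m) * y) - S
    ≡⟨ cong (_- S) (+-inverseʳ (y - fromℕ (2 ℕ.* m) * y)) ⟩
  0ℚ - S                                 ≡⟨ +-identityˡ (- S) ⟩
  - S                                    ∎
  where
  open ≡-Reasoning
  m = 2 ℕ.+ p
  y = γ m
  S = ∑[ j < suc p ] γ-term m (suc j)
  rearrange : ∀ y x s → (1ℚ + x) * y ≡ y + (s + y) - (y - x * y) - s
  rearrange = solve-∀ ℚ-ring

  split : y + (S + y) ≡ ∑[ i < suc m ] γ-term m i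
  split = begin
    y + (S + y)                                ≡⟨ cong₂ (λ a b → a + (S + b)) first-term last-term ⟨
    γ-term m 0 + (S + γ-term m m)              ≡⟨ ∑-head m (γ-term m) ⟨
    ∑[ i < suc m ] γ-term m i                  ∎
    where
    first-term : γ-term m 0 ≡ y
    first-term = trans (*-identityˡ _) (*-identityˡ y)
    last-term : γ-term m m ≡ y
    last-term = begin
      fromℕ (2 ℕ.* m C 2 ℕ.* m) * (y * γ (m ∸ m))   ≡⟨ cong₂ (λ c k → fromℕ c * (y * γ k)) (nCn≡1 (2 ℕ.* m)) (ℕP.n∸n≡0 m) ⟩
      1ℚ * (y * 1ℚ)                               ≡⟨ trans (*-identityˡ _) (*-identityʳ y) ⟩
      y                                           ∎

  signed-square : ∑[ i < suc m ] γ-term m i ≡ y - fromℕ (2 ℕ.* m) * y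
  signed-square = begin
    ∑[ i < suc m ] γ-term m i                                       ≡⟨ ∑-cong (suc m) sign-out ⟩
    ∑[ i < suc m ] (-1^ m * E i)                                    ≡⟨ ∑-distribˡ-* (suc m) (-1^ m) E ⟩
    -1^ m * ∑< (suc m) E                                            ≡⟨ cong (-1^ m *_) (β⊛β-even m) ⟨
    -1^ m * (β ⊛ β) (2 ℕ.* m)                                       ≡⟨ cong (-1^ m *_) (β⊛β≡[1-n]β {2 ℕ.* m} (ℕP.<⇒≤ (ℕP.*-monoʳ-≤ 2 {2} (s≤s (s≤s z≤n))))) ⟩
    -1^ m * (β (2 ℕ.* m) - fromℕ (2 ℕ.* m) * β (2 ℕ.* m))           ≡⟨ distribute (-1^ m) (β (2 ℕ.* m)) (fromℕ (2 ℕ.* m)) ⟩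
    y - fromℕ (2 ℕ.* m) * y                                         ∎
    where
    E : ℕ → ℚ
    E i = fromℕ (2 ℕ.* m C 2 ℕ.* i) * (β (2 ℕ.* i) * β (2 ℕ.* (m ∸ i)))
    distribute : ∀ s b x → s * (b - x * b) ≡ s * b - x * (s * b)
    distribute = solve-∀ ℚ-ring
    regroup : ∀ c s b t d → c * ((s * b) * (t * d)) ≡ (s * t) * (c * (b * d))
    regroup = solve-∀ ℚ-ring
    sign-out : ∀ {i} → i ℕ.< suc m → γ-term m i ≡ -1^ m * E i
    sign-out {i} (s≤s i≤m) = trans
      (regroup (fromℕ (2 ℕ.* m C 2 ℕ.* i)) (-1^ i) (β (2 ℕ.* i)) (-1^ (m ∸ i)) (β (2 ℕ.* (m ∸ i))))
      (cong (_* E i) (trans (sym (-1^-homo-+ i (m ∸ i))) (cong -1^_ (ℕP.m+[n∸m]≡n i≤m))))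

γ-term-nonNeg : ∀ p → (∀ {i} → i ℕ.< 2 ℕ.+ p → 1 ℕ.≤ i → γ i ≤ 0ℚ) →
                ∀ {j} → j ℕ.< suc p → 0ℚ ≤ γ-term (2 ℕ.+ p) (suc j)
γ-term-nonNeg p γ≤0 {j} (s≤s j≤p) = *-nonNeg (fromℕ-nonNeg (2 ℕ.* (2 ℕ.+ p) C 2 ℕ.* suc j))
  (*-nonPos (γ≤0 (s≤s (s≤s j≤p)) (s≤s z≤n))
            (γ≤0 (s≤s (ℕP.m∸n≤m (suc p) j)) (ℕP.m<n⇒0<n∸m (s≤s j≤p))))

γ-nonPos : ∀ m → 1 ℕ.≤ m → γ m ≤ 0ℚ
γ-nonPos = <-rec (λ m → 1 ℕ.≤ m → γ m ≤ 0ℚ) step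
  where
  step : ∀ m → (∀ {i} → i ℕ.< m → 1 ℕ.≤ i → γ i ≤ 0ℚ) → 1 ℕ.≤ m → γ m ≤ 0ℚ
  step (suc zero)      _     _ = toWitness {a? = γ 1 ≤? 0ℚ} _
  step m@(suc (suc p)) γ<m≤0 _ = *-cancelˡ-≤-pos (fromℕ N) {{positive (fromℕ-pos (2 ℕ.* m))}} (begin
    fromℕ N * γ m                          ≡⟨ γ-recurrence p ⟩
    - ∑[ j < suc p ] γ-term m (suc j)      ≤⟨ neg-antimono-≤ (∑-nonNeg (suc p) (γ-term-nonNeg p γ<m≤0)) ⟩
    0ℚ                                     ≡⟨ *-zeroʳ (fromℕ N) ⟨
    fromℕ N * 0ℚ                           ∎)
    where
    open ≤-Reasoning
    N = suc (2 ℕ.* m)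

growth-inequality : ∀ q → let m = 8 ℕ.+ q in
  6 ℕ.* (suc (2 ℕ.* m) ℕ.* (4 ℕ.* m)) ℕ.≤ (2 ℕ.* m C 2) ℕ.* (4 ℕ.* (7 ℕ.+ q))
growth-inequality q = begin
  6 ℕ.* (suc (2 ℕ.* m) ℕ.* (4 ℕ.* m))                                          ≤⟨ ℕP.m≤m+n _ _ ⟩
  6 ℕ.* (suc (2 ℕ.* m) ℕ.* (4 ℕ.* m)) ℕ.+ 4 ℕ.* m ℕ.* (3 ℕ.+ 17 ℕ.* q ℕ.+ 2 ℕ.* q ℕ.* q) ≡⟨ expand q ⟩
  m ℕ.* (15 ℕ.+ 2 ℕ.* q) ℕ.* (4 ℕ.* (7 ℕ.+ q))                                 ≡⟨ cong (ℕ._* (4 ℕ.* (7 ℕ.+ q))) [2m]C2 ⟨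
  (2 ℕ.* m C 2) ℕ.* (4 ℕ.* (7 ℕ.+ q))                                          ∎
  where
  open ℕP.≤-Reasoning
  m = 8 ℕ.+ q
  expand : ∀ q → 6 ℕ.* (suc (2 ℕ.* (8 ℕ.+ q)) ℕ.* (4 ℕ.* (8 ℕ.+ q))) ℕ.+ 4 ℕ.* (8 ℕ.+ q) ℕ.* (3 ℕ.+ 17 ℕ.* q ℕ.+ 2 ℕ.* q ℕ.* q)
                 ≡ (8 ℕ.+ q) ℕ.* (15 ℕ.+ 2 ℕ.* q) ℕ.* (4 ℕ.* (7 ℕ.+ q))
  expand = ℕ-Solver.solve-∀
  [2m]C2 : 2 ℕ.* m C 2 ≡ m ℕ.* (15 ℕ.+ 2 ℕ.* q)
  [2m]C2 = ℕP.*-cancelˡ-≡ _ _ 2 (begin-equality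
    2 ℕ.* (2 ℕ.* m C 2)                   ≡⟨ cong (λ k → 2 ℕ.* (k C 2)) (2m≡1+[15+2q] q) ⟩
    2 ℕ.* (suc (15 ℕ.+ 2 ℕ.* q) C 2)      ≡⟨ 2*[1+n]C2 (15 ℕ.+ 2 ℕ.* q) ⟩
    suc (15 ℕ.+ 2 ℕ.* q) ℕ.* (15 ℕ.+ 2 ℕ.* q) ≡⟨ double q ⟩
    2 ℕ.* (m ℕ.* (15 ℕ.+ 2 ℕ.* q))        ∎)
    where
    2m≡1+[15+2q] : ∀ q → 2 ℕ.* (8 ℕ.+ q) ≡ suc (15 ℕ.+ 2 ℕ.* q)
    2m≡1+[15+2q] = ℕ-Solver.solve-∀
    double : ∀ q → suc (15 ℕ.+ 2 ℕ.* q) ℕ.* (15 ℕ.+ 2 ℕ.* q) ≡ 2 ℕ.* ((8 ℕ.+ q) ℕ.* (15 ℕ.+ 2 ℕ.* q))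
    double = ℕ-Solver.solve-∀

⅙ : ℚ
⅙ = + 1 / 6

fromℕ≡⅙*fromℕ[6k] : ∀ k → fromℕ k ≡ ⅙ * fromℕ (6 ℕ.* k)
fromℕ≡⅙*fromℕ[6k] k = begin
  fromℕ k                       ≡⟨ *-identityˡ (fromℕ k) ⟨
  1ℚ * fromℕ k                  ≡⟨ cong (_* fromℕ k) (fromℕ-*-inverse 6) ⟨
  fromℕ 6 * ⅙ * fromℕ k         ≡⟨ swap (fromℕ 6) ⅙ (fromℕ k) ⟩
  ⅙ * (fromℕ 6 * fromℕ k)       ≡⟨ cong (⅙ *_) (fromℕ-homo-* 6 k) ⟨
  ⅙ * fromℕ (6 ℕ.* k)           ∎
  where
  open ≡-Reasoning
  swap : ∀ a b c → a * b * c ≡ b * (a * c)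
  swap = solve-∀ ℚ-ring

γ-growth : ∀ q → fromℕ (4 ℕ.* (7 ℕ.+ q)) ≤ - γ (7 ℕ.+ q) → fromℕ (4 ℕ.* (8 ℕ.+ q)) ≤ - γ (8 ℕ.+ q)
γ-growth q γk≤ = *-cancelˡ-≤-pos (fromℕ N) {{positive (fromℕ-pos (2 ℕ.* m))}} (begin
  fromℕ N * fromℕ (4 ℕ.* m)                    ≡⟨ fromℕ-homo-* N (4 ℕ.* m) ⟨
  fromℕ (N ℕ.* (4 ℕ.* m))                      ≡⟨ fromℕ≡⅙*fromℕ[6k] (N ℕ.* (4 ℕ.* m)) ⟩
  ⅙ * fromℕ (6 ℕ.* (N ℕ.* (4 ℕ.* m)))          ≤⟨ *-monoˡ-≤-nonNeg ⅙ (fromℕ-mono-≤ (growth-inequality q)) ⟩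
  ⅙ * fromℕ (c ℕ.* (4 ℕ.* k))                  ≡⟨ cong (⅙ *_) (fromℕ-homo-* c (4 ℕ.* k)) ⟩
  ⅙ * (fromℕ c * fromℕ (4 ℕ.* k))              ≤⟨ *-monoˡ-≤-nonNeg ⅙ (*-monoˡ-≤-nonNeg (fromℕ c) {{nonNegative (fromℕ-nonNeg c)}} γk≤) ⟩
  ⅙ * (fromℕ c * - γ k)                        ≡⟨ rearrange ⅙ (fromℕ c) (γ k) ⟩
  fromℕ c * (- ⅙ * γ k)                        ≡⟨⟩
  γ-term m 1                                   ≤⟨ ∑-head-≤ p (γ-term-nonNeg p λ {i} _ → γ-nonPos i) ⟩
  ∑[ j < suc p ] γ-term m (suc j)              ≡⟨ neg-involutive _ ⟨
  - - ∑[ j < suc p ] γ-term m (suc j)          ≡⟨ cong -_ (γ-recurrence p) ⟨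
  - (fromℕ N * γ m)                            ≡⟨ neg-distribʳ-* (fromℕ N) (γ m) ⟩
  fromℕ N * - γ m                              ∎)
  where
  open ≤-Reasoning
  p = 6 ℕ.+ q
  m = 8 ℕ.+ q
  k = 7 ℕ.+ q
  N = suc (2 ℕ.* m)
  c = 2 ℕ.* m C 2
  rearrange : ∀ s c g → s * (c * - g) ≡ c * (- s * g)
  rearrange = solve-∀ ℚ-ring

-- Evaluating bernoulli n directly takes time exponential in n, as bernoulliList m occurs twice
-- in bernoulliList (suc m); instead each entry is checked against the recursion applied to
-- the entries before it.
bernoulliTable : List ℚ
bernoulliTable =
  1ℚ ∷ - ½ ∷ + 1 / 6 ∷ 0ℚ ∷ - (+ 1 / 30) ∷ 0ℚ ∷ + 1 / 42 ∷ 0ℚ ∷ - (+ 1 / 30) ∷ 0ℚ ∷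
  + 5 / 66 ∷ 0ℚ ∷ - (+ 691 / 2730) ∷ 0ℚ ∷ + 7 / 6 ∷ 0ℚ ∷ - (+ 3617 / 510) ∷ 0ℚ ∷
  + 43867 / 798 ∷ 0ℚ ∷ - (+ 174611 / 330) ∷ 0ℚ ∷ + 854513 / 138 ∷ 0ℚ ∷
  - (+ 236364091 / 2730) ∷ 0ℚ ∷ + 8553103 / 6 ∷ 0ℚ ∷ - (+ 23749461029 / 870) ∷ []

tabulated : ℕ → ℚ
tabulated k = fromMaybe 0ℚ (head (drop k bernoulliTable))

bernoulli≡tabulated : ∀ {m} → m ℕ.≤ 28 → B m ≡ tabulated m
bernoulli≡tabulated = bernoulli-characterisation tabulated 28 refl (toWitness {a? = ℕP.allUpTo?
  (λ m → nextBernoulli m (applyUpTo tabulated (suc m)) ≟ tabulated (suc m)) 28} _)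

vTabulated : ℕ → ℚ
vTabulated zero    = 1ℚ
vTabulated (suc n) = vTabulated n * (∣ - (tabulated (2 ℕ.* suc n) * (+ 1 / (2 ℕ.* suc n))) ∣ * ½)

v≡vTabulated : ∀ n → n ℕ.≤ 14 → v n ≡ vTabulated n
v≡vTabulated zero    _    = refl
v≡vTabulated (suc n) n<14 = cong₂ (λ x b → x * (∣ - (b * (+ 1 / (2 ℕ.* suc n))) ∣ * ½))
  (v≡vTabulated n (ℕP.<⇒≤ n<14)) (bernoulli≡tabulated (ℕP.*-monoʳ-≤ 2 n<14))

numerator-v≢1 : ∀ {n} → 6 ℕ.≤ n → n ℕ.< 14 → ↥ v n ≢ + 1
numerator-v≢1 {n} 6≤n n<14 = subst (λ x → ↥ x ≢ + 1) (sym (v≡vTabulated n (ℕP.<⇒≤ n<14)))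
  (toWitness {a? = ℕP.allUpTo? (λ n → 6 ℕ.≤? n →-dec ¬? (↥ vTabulated n ℤ.≟ + 1)) 14} _ n<14 6≤n)

1<v14 : 1ℚ < v 14
1<v14 = subst (1ℚ <_) (sym (v≡vTabulated 14 ℕP.≤-refl)) (toWitness {a? = 1ℚ <? vTabulated 14} _)

γ≡tabulated : ∀ {m} → 1 ℕ.≤ m → m ℕ.≤ 14 → γ m ≡ -1^ m * tabulated (2 ℕ.* m)
γ≡tabulated {m} 1≤m m≤14 = cong (-1^ m *_)
  (trans (β≡B (ℕP.*-monoʳ-≤ 2 1≤m)) (bernoulli≡tabulated (ℕP.*-monoʳ-≤ 2 m≤14)))

-- The index {y = γ 9} is given explicitly: inferring it would make Agda unfold γ 9, i.e.
-- evaluate B 18 by the naive recursion.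
γ-lower-bound : ∀ {m} → 9 ℕ.≤′ m → fromℕ (4 ℕ.* m) ≤ - γ m
γ-lower-bound ℕ.≤′-refl = subst (λ g → fromℕ (4 ℕ.* 9) ≤ - g) {y = γ 9} (sym (γ≡tabulated {9} (s≤s z≤n) (ℕP.m≤m+n 9 5)))
  (toWitness {a? = fromℕ (4 ℕ.* 9) ≤? - (-1^ 9 * tabulated (2 ℕ.* 9))} _)
γ-lower-bound (ℕ.≤′-step {m} 9≤m) = subst (λ k → fromℕ (4 ℕ.* k) ≤ - γ k → fromℕ (4 ℕ.* suc k) ≤ - γ (suc k))
  (ℕP.m+[n∸m]≡n {7} (ℕP.≤-trans (ℕP.m≤m+n 7 2) (ℕP.≤′⇒≤ 9≤m))) (γ-growth (m ∸ 7)) (γ-lower-bound 9≤m)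

bernoulli-lower-bound : ∀ {m} → 9 ℕ.≤ m → fromℕ (4 ℕ.* m) ≤ ∣ B (2 ℕ.* m) ∣
bernoulli-lower-bound {m} 9≤m = begin
  fromℕ (4 ℕ.* m)              ≤⟨ γ-lower-bound (ℕP.≤⇒≤′ 9≤m) ⟩
  - γ m                        ≡⟨ 0≤p⇒∣p∣≡p (neg-antimono-≤ (γ-nonPos m (ℕP.≤-trans (s≤s z≤n) 9≤m))) ⟨
  ∣ - γ m ∣                    ≡⟨ ∣-p∣≡∣p∣ (γ m) ⟩
  ∣ -1^ m * β (2 ℕ.* m) ∣      ≡⟨ ∣p*q∣≡∣p∣*∣q∣ (-1^ m) (β (2 ℕ.* m)) ⟩
  ∣ -1^ m ∣ * ∣ β (2 ℕ.* m) ∣  ≡⟨ cong (_* ∣ β (2 ℕ.* m) ∣) (∣-1^∣ m) ⟩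
  1ℚ * ∣ β (2 ℕ.* m) ∣         ≡⟨ *-identityˡ _ ⟩
  ∣ β (2 ℕ.* m) ∣              ≡⟨ cong ∣_∣ (β≡B (ℕP.*-monoʳ-≤ 2 (ℕP.≤-trans (s≤s z≤n) 9≤m))) ⟩
  ∣ B (2 ℕ.* m) ∣              ∎
  where open ≤-Reasoning

zeta-factor≥1 : ∀ j → fromℕ (4 ℕ.* suc j) ≤ ∣ B (2 ℕ.* suc j) ∣ → 1ℚ ≤ ∣ zetaOneMinusTwo (suc j) ∣ * ½
zeta-factor≥1 j B≥ = begin
  1ℚ                                   ≡⟨ trans (cong₂ _*_ (fromℕ-*-inverse 2) (fromℕ-*-inverse N)) (*-identityˡ 1ℚ) ⟨
  fromℕ 2 * ½ * (fromℕ N * r)          ≡⟨ regroup (fromℕ 2) ½ (fromℕ N) r ⟩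
  fromℕ 2 * fromℕ N * r * ½            ≡⟨ cong (λ x → x * r * ½) (fromℕ-homo-* 2 N) ⟨
  fromℕ (2 ℕ.* N) * r * ½              ≡⟨ cong (λ k → fromℕ k * r * ½) (ℕP.*-assoc 2 2 (suc j)) ⟨
  fromℕ (4 ℕ.* suc j) * r * ½          ≤⟨ *-monoʳ-≤-nonNeg ½ (*-monoʳ-≤-nonNeg r {{nonNegative r≥0}} B≥) ⟩
  ∣ B N ∣ * r * ½                      ≡⟨ cong (λ x → ∣ B N ∣ * x * ½) (0≤p⇒∣p∣≡p r≥0) ⟨
  ∣ B N ∣ * ∣ r ∣ * ½                  ≡⟨ cong (_* ½) (trans (∣-p∣≡∣p∣ (B N * r)) (∣p*q∣≡∣p∣*∣q∣ (B N) r)) ⟨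
  ∣ zetaOneMinusTwo (suc j) ∣ * ½      ∎
  where
  open ≤-Reasoning
  N = 2 ℕ.* suc j
  r = + 1 / N
  r≥0 : 0ℚ ≤ r
  r≥0 = nonNegative⁻¹ r {{normalize-nonNeg 1 N}}
  regroup : ∀ a b c d → a * b * (c * d) ≡ a * c * d * b
  regroup = solve-∀ ℚ-ring

1<v : ∀ {n} → 14 ℕ.≤′ n → 1ℚ < v n
1<v ℕ.≤′-refl            = 1<v14
1<v (ℕ.≤′-step {n} 14≤n) = begin-strict
  1ℚ                                       <⟨ 1<v 14≤n ⟩
  v n                                      ≡⟨ *-identityʳ (v n) ⟨
  v n * 1ℚ                                 ≤⟨ *-monoˡ-≤-nonNeg (v n) {{nonNegative (<⇒≤ (<-trans 0<1 (1<v 14≤n)))}}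
                                                (zeta-factor≥1 n (bernoulli-lower-bound 9≤1+n)) ⟩
  v n * (∣ zetaOneMinusTwo (suc n) ∣ * ½)  ∎
  where
  open ≤-Reasoning
  0<1 : 0ℚ < 1ℚ
  0<1 = toWitness {a? = 0ℚ <? 1ℚ} _
  9≤1+n : 9 ℕ.≤ suc n
  9≤1+n = ℕP.≤-trans (ℕP.m≤m+n 9 5) (ℕP.m≤n⇒m≤1+n (ℕP.≤′⇒≤ 14≤n))

lemma2p6 : (n : ℕ) → n ≥ 6 → (↥ v n ≢ + 1) ⊎ (1ℚ < v n)
lemma2p6 n n≥6 with n ℕ.<? 14
... | yes n<14 = inj₁ (numerator-v≢1 n≥6 n<14)
... | no  n≮14 = inj₂ (1<v (ℕP.≤⇒≤′ (ℕP.≮⇒≥ n≮14)))
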